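{- Let $G$ be a minimally imperfect graph, and let $A,B,C,D$ be a partition of $V(G)$ into four nonempty sets such that every vertex of $A$ is adjacent to every vertex of $B$ and no vertex of $C$ is adjacent to any vertex of $D$. Let $\omega=\omega(G)$. Then no clique of $G$ of size $\omega$ is contained in $A\cup B$.
   Context: All graphs are finite and simple. $\omega(H)$ denotes the size of a largest clique of $H$ and $\chi(H)$ its chromatic number. A graph $G$ is perfect if $\omega(H)=\chi(H)$ for every induced subgraph $H$ of $G$; it is minimally imperfect if it is not perfect but every proper induced subgraph is perfect. -}

module Defs where

open import Data.Nat using (ℕ; _≤_)
open import Data.Fin using (Fin)
open import Data.Fin.Subset using (Subset; _∈_; _∉_; _⊆_; ∣_∣; ⊤)
open import Data.Bool using (Bool; true; false)
open import Data.Product using (Σ; ∃; _×_)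
open import Relation.Binary.PropositionalEquality using (_≡_; _≢_)
open import Relation.Nullary using (¬_)

record Graph (n : ℕ) : Set where
  field
    adj    : Fin n → Fin n → Bool
    sym    : ∀ u v → adj u v ≡ adj v u
    irrefl : ∀ v → adj v v ≡ false
open Graph public

module _ {n : ℕ} (G : Graph n) where

  IsClique : Subset n → Set
  IsClique K = ∀ u v → u ∈ K → v ∈ K → u ≢ v → adj G u v ≡ true

  IsCliqueNumber : Subset n → ℕ → Set
  IsCliqueNumber S w =
    (Σ (Subset n) λ K → K ⊆ S × IsClique K × ∣ K ∣ ≡ w)
    × (∀ K → K ⊆ S → IsClique K → ∣ K ∣ ≤ w)

  Colouring : Subset n → ℕ → Set
  Colouring S k =
    Σ ((v : Fin n) → v ∈ S → Fin k) λ c →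
      ∀ u v (u∈ : u ∈ S) (v∈ : v ∈ S) → adj G u v ≡ true → c u u∈ ≢ c v v∈

  IsChromaticNumber : Subset n → ℕ → Set
  IsChromaticNumber S k = Colouring S k × (∀ j → Colouring S j → k ≤ j)

  PerfectOn : Subset n → Set
  PerfectOn S = ∀ T → T ⊆ S → ∃ λ k → IsCliqueNumber T k × IsChromaticNumber T k

  Perfect : Set
  Perfect = PerfectOn ⊤

  MinimallyImperfect : Set
  MinimallyImperfect = ¬ Perfect × (∀ T → (∃ λ v → v ∉ T) → PerfectOn T)

{-# OPTIONS --safe #-}
-- Suppose the ω-clique K lies in A ∪ B. G − D and G − C are proper, hence perfect; colour each with
-- as many colours as its clique number. Let T consist of A and of every vertex of C (of D) whose
-- colour in G − D (in G − C) does not occur on K ∩ B. Since C and D are anticomplete, every clique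
-- lies in G − D or in G − C, and in the matching colouring a clique of T uses no colour of K ∩ B
-- (A is complete to B), while a clique of ∁ T uses no colour of K ∩ A (its vertices in C ∪ D share
-- a colour with a vertex of K ∩ B, which is complete to A). Hence ω(T) ≤ |K ∩ A| and
-- ω(∁ T) ≤ |K ∩ B|. T and ∁ T are proper, hence perfect, so G is ω-colourable, and then G itself
-- would be perfect.
module Submission where

open import Defs hiding (sym)
open import Data.Nat using (ℕ; zero; suc; _+_; _≤_)
open import Data.Nat.Properties using (+-suc; +-cancelʳ-≤; +-cancelˡ-≤; +-mono-≤; module ≤-Reasoning)
open import Data.Bool using (Bool; true; false; not)
open import Data.Bool.Properties using (not-¬)
open import Data.Fin using (Fin; zero; suc; splitAt; join; inject≤)
open import Data.Fin.Patterns using (0F; 1F; 2F; 3F)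
open import Data.Fin.Properties using (injective⇒≤; join-splitAt; splitAt-join; inject≤-injective; any?; suc-injective; _≟_)
open import Data.Fin.Subset using (Subset; _∈_; _∉_; _⊆_; ∣_∣; ⊤; _∩_; ∁; Nonempty)
open import Data.Fin.Subset.Properties using (_∈?_; ⊆-refl; ⊆⊤; p∩q⊆p; p∩q⊆q; x∈∁p⇒x∉p; x∈p⇒x∉∁p; x∉p⇒x∈∁p; x∉∁p⇒x∈p; nonempty?)
open import Data.Vec using ([]; _∷_; tabulate; here; there)
open import Data.Vec.Properties using ([]=⇒lookup; lookup⇒[]=; lookup∘tabulate)
open import Data.Product using (Σ; ∃; _×_; _,_; proj₁; proj₂)
open import Data.Sum using (_⊎_; inj₁; inj₂; [_,_]′)
open import Data.Sum.Properties using (inj₁-injective; inj₂-injective)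
open import Data.Empty using (⊥; ⊥-elim)
open import Data.Unit using (tt) renaming (⊤ to Unit)
open import Level using (0ℓ)
open import Function using (_∘_)
open import Function.Definitions using (Injective)
open import Relation.Unary using (Pred; Decidable)
open import Relation.Binary.PropositionalEquality using (_≡_; _≢_; refl; sym; trans; cong; subst)
open import Relation.Nullary using (¬_; Dec; yes; no; does)
open import Relation.Nullary.Decidable using (dec-true; _×-dec_; ¬?)

module _ {n : ℕ} where

  subset : {P : Pred (Fin n) 0ℓ} → Decidable P → Subset n
  subset P? = tabulate (does ∘ P?)

  ∈-subset⁺ : {P : Pred (Fin n) 0ℓ} (P? : Decidable P) {v : Fin n} → P v → v ∈ subset P?
  ∈-subset⁺ P? {v} Pv = lookup⇒[]= v _ (trans (lookup∘tabulate _ v) (dec-true (P? v) Pv))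

  ∈-subset⁻ : {P : Pred (Fin n) 0ℓ} (P? : Decidable P) {v : Fin n} → v ∈ subset P? → P v
  ∈-subset⁻ P? {v} v∈ with P? v | trans (sym (lookup∘tabulate (does ∘ P?) v)) ([]=⇒lookup v∈)
  ... | yes Pv | _ = Pv
  ... | no _   | ()

enumerate : ∀ {n} (p : Subset n) → Fin ∣ p ∣ → Fin n
enumerate (true ∷ p)  zero    = zero
enumerate (true ∷ p)  (suc i) = suc (enumerate p i)
enumerate (false ∷ p) i       = suc (enumerate p i)

enumerate-∈ : ∀ {n} (p : Subset n) i → enumerate p i ∈ p
enumerate-∈ (true ∷ p)  zero    = here
enumerate-∈ (true ∷ p)  (suc i) = there (enumerate-∈ p i)
enumerate-∈ (false ∷ p) i       = there (enumerate-∈ p i)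

enumerate-injective : ∀ {n} (p : Subset n) → Injective _≡_ _≡_ (enumerate p)
enumerate-injective (true ∷ p)  {zero}  {zero}  _  = refl
enumerate-injective (true ∷ p)  {suc i} {suc j} eq = cong suc (enumerate-injective p (suc-injective eq))
enumerate-injective (false ∷ p) eq = enumerate-injective p (suc-injective eq)

splitAt-injective : ∀ m n → Injective _≡_ _≡_ (splitAt m {n})
splitAt-injective m n {i} {j} eq =
  trans (sym (join-splitAt m n i)) (trans (cong (join m n) eq) (join-splitAt m n j))

join-injective : ∀ m n → Injective _≡_ _≡_ (join m n)
join-injective m n {i} {j} eq =
  trans (sym (splitAt-join m n i)) (trans (cong (splitAt m) eq) (splitAt-join m n j))

InjectiveOn : ∀ {n} {A : Set} → Subset n → (Fin n → A) → Set
InjectiveOn p f = ∀ {u v} → u ∈ p → v ∈ p → f u ≡ f v → u ≡ v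

module _ {n m : ℕ} {f : Fin n → Fin m} where

  injectiveOn⇒∣p∣≤m : {p : Subset n} → InjectiveOn p f → ∣ p ∣ ≤ m
  injectiveOn⇒∣p∣≤m {p} f-inj =
    injective⇒≤ (enumerate-injective p ∘ f-inj (enumerate-∈ p _) (enumerate-∈ p _))

  injectiveOn⇒∣p∣+∣q∣≤m : {p q : Subset n} → InjectiveOn p f → InjectiveOn q f →
    (∀ {u v} → u ∈ p → v ∈ q → f u ≢ f v) → ∣ p ∣ + ∣ q ∣ ≤ m
  injectiveOn⇒∣p∣+∣q∣≤m {p} {q} p-inj q-inj disjoint =
    injective⇒≤ (splitAt-injective ∣ p ∣ ∣ q ∣ ∘ both-injective)
    where
    both : Fin ∣ p ∣ ⊎ Fin ∣ q ∣ → Fin m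
    both = [ f ∘ enumerate p , f ∘ enumerate q ]′

    both-injective : Injective _≡_ _≡_ both
    both-injective {inj₁ i} {inj₁ j} eq =
      cong inj₁ (enumerate-injective p (p-inj (enumerate-∈ p i) (enumerate-∈ p j) eq))
    both-injective {inj₂ i} {inj₂ j} eq =
      cong inj₂ (enumerate-injective q (q-inj (enumerate-∈ q i) (enumerate-∈ q j) eq))
    both-injective {inj₁ i} {inj₂ j} eq = ⊥-elim (disjoint (enumerate-∈ p i) (enumerate-∈ q j) eq)
    both-injective {inj₂ i} {inj₁ j} eq = ⊥-elim (disjoint (enumerate-∈ p j) (enumerate-∈ q i) (sym eq))

∣p∩q∣+∣p∩∁q∣≡∣p∣ : ∀ {n} (p q : Subset n) → ∣ p ∩ q ∣ + ∣ p ∩ ∁ q ∣ ≡ ∣ p ∣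
∣p∩q∣+∣p∩∁q∣≡∣p∣ []          []          = refl
∣p∩q∣+∣p∩∁q∣≡∣p∣ (false ∷ p) (_ ∷ q)     = ∣p∩q∣+∣p∩∁q∣≡∣p∣ p q
∣p∩q∣+∣p∩∁q∣≡∣p∣ (true ∷ p)  (true ∷ q)  = cong suc (∣p∩q∣+∣p∩∁q∣≡∣p∣ p q)
∣p∩q∣+∣p∩∁q∣≡∣p∣ (true ∷ p)  (false ∷ q) = trans (+-suc ∣ p ∩ q ∣ ∣ p ∩ ∁ q ∣) (cong suc (∣p∩q∣+∣p∩∁q∣≡∣p∣ p q))

module _ {n : ℕ} (G : Graph n) where

  ProperOn : {C : Set} → Subset n → (Fin n → C) → Set
  ProperOn S c = ∀ {u v} → u ∈ S → v ∈ S → adj G u v ≡ true → c u ≢ c v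

  properOn-∘ : {C D : Set} {S : Subset n} {c : Fin n → C} {f : C → D} →
    Injective _≡_ _≡_ f → ProperOn S c → ProperOn S (f ∘ c)
  properOn-∘ f-inj c-proper u∈ v∈ uv = c-proper u∈ v∈ uv ∘ f-inj

  clique-⊆ : {P Q : Subset n} → P ⊆ Q → IsClique G Q → IsClique G P
  clique-⊆ P⊆Q Q-clique u v u∈ v∈ = Q-clique u v (P⊆Q u∈) (P⊆Q v∈)

  properOn⇒injectiveOn-clique : {C : Set} {S Q : Subset n} {c : Fin n → C} →
    ProperOn S c → IsClique G Q → Q ⊆ S → InjectiveOn Q c
  properOn⇒injectiveOn-clique c-proper Q-clique Q⊆S {u} {v} u∈ v∈ cu≡cv with u ≟ v
  ... | yes u≡v = u≡v
  ... | no  u≢v = ⊥-elim (c-proper (Q⊆S u∈) (Q⊆S v∈) (Q-clique u v u∈ v∈ u≢v) cu≡cv)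

  clique≤colours : {k : ℕ} {S Q : Subset n} {c : Fin n → Fin k} →
    ProperOn S c → IsClique G Q → Q ⊆ S → ∣ Q ∣ ≤ k
  clique≤colours c-proper Q-clique Q⊆S =
    injectiveOn⇒∣p∣≤m (properOn⇒injectiveOn-clique c-proper Q-clique Q⊆S)

  cliques-with-disjoint-colours : {k : ℕ} {S P Q : Subset n} {c : Fin n → Fin k} →
    ProperOn S c → IsClique G P → P ⊆ S → IsClique G Q → Q ⊆ S →
    (∀ {u v} → u ∈ P → v ∈ Q → c u ≢ c v) → ∣ P ∣ + ∣ Q ∣ ≤ k
  cliques-with-disjoint-colours c-proper P-clique P⊆S Q-clique Q⊆S =
    injectiveOn⇒∣p∣+∣q∣≤m (properOn⇒injectiveOn-clique c-proper P-clique P⊆S)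
                          (properOn⇒injectiveOn-clique c-proper Q-clique Q⊆S)

  glue : {C₁ C₂ : Set} → Subset n → (Fin n → C₁) → (Fin n → C₂) → Fin n → C₁ ⊎ C₂
  glue T c₁ c₂ v with v ∈? T
  ... | yes _ = inj₁ (c₁ v)
  ... | no  _ = inj₂ (c₂ v)

  properOn-glue : {C₁ C₂ : Set} {T : Subset n} {c₁ : Fin n → C₁} {c₂ : Fin n → C₂} →
    ProperOn T c₁ → ProperOn (∁ T) c₂ → ProperOn ⊤ (glue T c₁ c₂)
  properOn-glue {T = T} c₁-proper c₂-proper {u} {v} _ _ uv with u ∈? T | v ∈? T
  ... | yes u∈ | yes v∈ = c₁-proper u∈ v∈ uv ∘ inj₁-injective
  ... | no  u∉ | no  v∉ = c₂-proper (x∉p⇒x∈∁p u∉) (x∉p⇒x∈∁p v∉) uv ∘ inj₂-injective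
  ... | yes _  | no  _  = λ ()
  ... | no  _  | yes _  = λ ()

  -- The clique certifies colours = ω(G[S]); colour is total, with arbitrary values outside S.
  record OptimalColouring (S : Subset n) : Set where
    field
      colours           : ℕ
      colour            : Fin n → Fin colours
      proper            : ProperOn S colour
      clique            : Subset n
      clique⊆S          : clique ⊆ S
      isClique          : IsClique G clique
      ∣clique∣≡colours : ∣ clique ∣ ≡ colours

  perfect⇒optimalColouring : {S : Subset n} → PerfectOn G S → Nonempty S → OptimalColouring S
  perfect⇒optimalColouring {S} S-perfect (v₀ , v₀∈S) with S-perfect S ⊆-refl
  ... | k , ((Q , Q⊆S , Q-clique , ∣Q∣≡k) , _) , ((c , c-proper) , _) = record
    { colours = k ; colour = total ; proper = total-proper
    ; clique = Q ; clique⊆S = Q⊆S ; isClique = Q-clique ; ∣clique∣≡colours = ∣Q∣≡k }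
    where
    total : Fin n → Fin k
    total v with v ∈? S
    ... | yes v∈S = c v v∈S
    ... | no  _   = c v₀ v₀∈S

    total-proper : ProperOn S total
    total-proper {u} {v} u∈S v∈S uv with u ∈? S | v ∈? S
    ... | yes u∈ | yes v∈ = c-proper u v u∈ v∈ uv
    ... | no  u∉ | _      = ⊥-elim (u∉ u∈S)
    ... | _      | no  v∉ = ⊥-elim (v∉ v∈S)

  optimalColouring-colours≤ : {S : Subset n} {m : ℕ} (C : OptimalColouring S) →
    (∀ {Q} → IsClique G Q → Q ⊆ S → ∣ Q ∣ ≤ m) → OptimalColouring.colours C ≤ m
  optimalColouring-colours≤ C ω≤m = subst (_≤ _) ∣clique∣≡colours (ω≤m isClique clique⊆S)
    where open OptimalColouring C

  ω-colourable⇒perfect : (∀ T → (∃ λ v → v ∉ T) → PerfectOn G T) →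
    {K : Subset n} → IsClique G K → (∀ Q → IsClique G Q → ∣ Q ∣ ≤ ∣ K ∣) →
    (c : Fin n → Fin ∣ K ∣) → ProperOn ⊤ c → Perfect G
  ω-colourable⇒perfect proper⇒perfect {K} K-clique K-maximum c c-proper T _ with nonempty? (∁ T)
  ... | yes (v , v∈∁T) = proper⇒perfect T (v , x∈∁p⇒x∉p v∈∁T) T ⊆-refl
  ... | no  ∁T-empty   =
    ∣ K ∣ , ((K , (λ {v} _ → all∈T v) , K-clique , refl) , (λ Q _ Q-clique → K-maximum Q Q-clique))
          , ((λ v _ → c v) , (λ u v _ _ → c-proper (⊆⊤ (all∈T u)) (⊆⊤ (all∈T v))))
          , (λ j → lower-bound)
    where
    all∈T : ∀ v → v ∈ T
    all∈T v = x∉∁p⇒x∈p (λ v∈∁T → ∁T-empty (v , v∈∁T))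

    lower-bound : ∀ {j} → Colouring G T j → ∣ K ∣ ≤ j
    lower-bound (d , d-proper) =
      clique≤colours {c = λ v → d v (all∈T v)}
        (λ {u} {v} _ _ → d-proper u v (all∈T u) (all∈T v)) K-clique (λ {v} _ → all∈T v)

module FourPartition {n : ℕ} (G : Graph n) (part : Fin n → Fin 4)
  (part-nonempty : ∀ i → ∃ λ v → part v ≡ i)
  (A-B-complete : ∀ u v → part u ≡ 0F → part v ≡ 1F → adj G u v ≡ true)
  (C-D-anticomplete : ∀ u v → part u ≡ 2F → part v ≡ 3F → adj G u v ≡ false)
  (proper⇒perfect : ∀ T → (∃ λ v → v ∉ T) → PerfectOn G T)
  (K : Subset n) (K-clique : IsClique G K) (K-maximum : ∀ Q → IsClique G Q → ∣ Q ∣ ≤ ∣ K ∣)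
  (K⊆A∪B : ∀ v → v ∈ K → part v ≡ 0F ⊎ part v ≡ 1F) where

  open OptimalColouring

  witness : Fin 4 → Fin n
  witness i = proj₁ (part-nonempty i)

  part-witness : ∀ i → part (witness i) ≡ i
  part-witness i = proj₂ (part-nonempty i)

  colours≤∣K∣ : {S : Subset n} (C : OptimalColouring G S) → colours C ≤ ∣ K ∣
  colours≤∣K∣ C = optimalColouring-colours≤ G C (λ Q-clique _ → K-maximum _ Q-clique)

  A? : Decidable (λ v → part v ≡ 0F)
  A? v = part v ≟ 0F

  K∩A K∩B : Subset n
  K∩A = K ∩ subset A?
  K∩B = K ∩ ∁ (subset A?)

  K-split : ∣ K∩A ∣ + ∣ K∩B ∣ ≡ ∣ K ∣
  K-split = ∣p∩q∣+∣p∩∁q∣≡∣p∣ K (subset A?)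

  K∩A-clique : IsClique G K∩A
  K∩A-clique = clique-⊆ G (p∩q⊆p K _) K-clique

  K∩B-clique : IsClique G K∩B
  K∩B-clique = clique-⊆ G (p∩q⊆p K _) K-clique

  K∩A-part : ∀ {w} → w ∈ K∩A → part w ≡ 0F
  K∩A-part w∈K∩A = ∈-subset⁻ A? (p∩q⊆q K _ w∈K∩A)

  K∩B-part : ∀ {w} → w ∈ K∩B → part w ≡ 1F
  K∩B-part {w} w∈K∩B with K⊆A∪B w (p∩q⊆p K _ w∈K∩B)
  ... | inj₁ w∈A = ⊥-elim (x∈∁p⇒x∉p (p∩q⊆q K _ w∈K∩B) (∈-subset⁺ A? w∈A))
  ... | inj₂ w∈B = w∈B

  -- Half true is G − D and Half false is G − C; kept h is the part among C, D that Half h keeps.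
  kept : Bool → Fin 4
  kept true  = 2F
  kept false = 3F

  Half? : ∀ h → Decidable (λ v → part v ≢ kept (not h))
  Half? h v = ¬? (part v ≟ kept (not h))

  Half : Bool → Subset n
  Half h = subset (Half? h)

  half-parts : ∀ h (i : Fin 4) → i ≢ kept (not h) → i ≡ 0F ⊎ i ≡ 1F ⊎ i ≡ kept h
  half-parts _     0F _   = inj₁ refl
  half-parts _     1F _   = inj₂ (inj₁ refl)
  half-parts true  2F _   = inj₂ (inj₂ refl)
  half-parts true  3F ¬3F = ⊥-elim (¬3F refl)
  half-parts false 2F ¬2F = ⊥-elim (¬2F refl)
  half-parts false 3F _   = inj₂ (inj₂ refl)

  A∪B-not-kept : ∀ h {i} → i ≡ 0F ⊎ i ≡ 1F → i ≢ kept h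
  A∪B-not-kept true  (inj₁ refl) ()
  A∪B-not-kept true  (inj₂ refl) ()
  A∪B-not-kept false (inj₁ refl) ()
  A∪B-not-kept false (inj₂ refl) ()

  K∩A⊆Half : ∀ h → K∩A ⊆ Half h
  K∩A⊆Half h w∈K∩A = ∈-subset⁺ (Half? h) (A∪B-not-kept (not h) (inj₁ (K∩A-part w∈K∩A)))

  K∩B⊆Half : ∀ h → K∩B ⊆ Half h
  K∩B⊆Half h w∈K∩B = ∈-subset⁺ (Half? h) (A∪B-not-kept (not h) (inj₂ (K∩B-part w∈K∩B)))

  clique-in-half : ∀ {Q} → IsClique G Q → ∃ λ h → Q ⊆ Half h
  clique-in-half {Q} Q-clique with any? (λ v → (v ∈? Q) ×-dec (part v ≟ 3F))
  ... | yes (d , d∈Q , d∈D) = false , λ {u} u∈Q → ∈-subset⁺ (Half? false) λ u∈C →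
    not-¬ (Q-clique u d u∈Q d∈Q (λ { refl → 2F≢3F (trans (sym u∈C) d∈D) }))
          (C-D-anticomplete u d u∈C d∈D)
    where
    2F≢3F : 2F ≢ 3F
    2F≢3F ()
  ... | no  no-D            = true , λ {u} u∈Q → ∈-subset⁺ (Half? true) λ u∈D → no-D (u , u∈Q , u∈D)

  colouring-of-half : ∀ h → OptimalColouring G (Half h)
  colouring-of-half h = perfect⇒optimalColouring G
    (proper⇒perfect (Half h) (witness (kept (not h)) , λ w∈ → ∈-subset⁻ (Half? h) w∈ (part-witness _)))
    (witness 0F , ∈-subset⁺ (Half? h) (A∪B-not-kept (not h) (inj₁ (part-witness 0F))))

  c : ∀ h → Fin n → Fin (colours (colouring-of-half h))
  c h = colour (colouring-of-half h)

  Hits : Bool → Fin n → Set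
  Hits h v = ∃ λ w → w ∈ K∩B × c h w ≡ c h v

  hits? : ∀ h v → Dec (Hits h v)
  hits? h v = any? (λ w → (w ∈? K∩B) ×-dec (c h w ≟ c h v))

  OnT : Fin 4 → Fin n → Set
  OnT 0F _ = Unit
  OnT 1F _ = ⊥
  OnT 2F v = ¬ Hits true v
  OnT 3F v = ¬ Hits false v

  T? : Decidable (λ v → OnT (part v) v)
  T? v = onT? (part v)
    where
    onT? : ∀ i → Dec (OnT i v)
    onT? 0F = yes tt
    onT? 1F = no λ ()
    onT? 2F = ¬? (hits? true v)
    onT? 3F = ¬? (hits? false v)

  T : Subset n
  T = subset T?

  A⊆T : ∀ {u} → part u ≡ 0F → u ∈ T
  A⊆T {u} u∈A = ∈-subset⁺ T? (subst (λ i → OnT i u) (sym u∈A) tt)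

  B∩T-empty : ∀ {u} → part u ≡ 1F → u ∉ T
  B∩T-empty {u} u∈B u∈T = subst (λ i → OnT i u) u∈B (∈-subset⁻ T? u∈T)

  ¬Hits-if-kept : ∀ h {u} → part u ≡ kept h → u ∈ T → ¬ Hits h u
  ¬Hits-if-kept true  {u} u∈C u∈T = subst (λ i → OnT i u) u∈C (∈-subset⁻ T? u∈T)
  ¬Hits-if-kept false {u} u∈D u∈T = subst (λ i → OnT i u) u∈D (∈-subset⁻ T? u∈T)

  Hits-if-kept : ∀ h {u} → part u ≡ kept h → u ∉ T → Hits h u
  Hits-if-kept h {u} u∈kept u∉T with hits? h u
  ... | yes hits = hits
  ... | no ¬hits = ⊥-elim (u∉T (∈-subset⁺ T? (onT u∈kept ¬hits)))
    where
    onT : ∀ {h} → part u ≡ kept h → ¬ Hits h u → OnT (part u) u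
    onT {true}  u∈C = subst (λ i → OnT i u) (sym u∈C)
    onT {false} u∈D = subst (λ i → OnT i u) (sym u∈D)

  T-avoids-K∩B : ∀ h {u w} → u ∈ Half h → u ∈ T → w ∈ K∩B → c h u ≢ c h w
  T-avoids-K∩B h {u} {w} u∈H u∈T w∈K∩B with half-parts h (part u) (∈-subset⁻ (Half? h) u∈H)
  ... | inj₁ u∈A          = proper (colouring-of-half h) u∈H (K∩B⊆Half h w∈K∩B)
                              (A-B-complete u w u∈A (K∩B-part w∈K∩B))
  ... | inj₂ (inj₁ u∈B)    = ⊥-elim (B∩T-empty u∈B u∈T)
  ... | inj₂ (inj₂ u∈kept) = λ cu≡cw → ¬Hits-if-kept h u∈kept u∈T (w , w∈K∩B , sym cu≡cw)

  K∩A-avoids-∁T : ∀ h {w u} → w ∈ K∩A → u ∈ Half h → u ∉ T → c h w ≢ c h u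
  K∩A-avoids-∁T h {w} {u} w∈K∩A u∈H u∉T with half-parts h (part u) (∈-subset⁻ (Half? h) u∈H)
  ... | inj₁ u∈A          = ⊥-elim (u∉T (A⊆T u∈A))
  ... | inj₂ (inj₁ u∈B)    = proper (colouring-of-half h) (K∩A⊆Half h w∈K∩A) u∈H
                              (A-B-complete w u (K∩A-part w∈K∩A) u∈B)
  ... | inj₂ (inj₂ u∈kept) with Hits-if-kept h u∈kept u∉T
  ... | w′ , w′∈K∩B , cw′≡cu = λ cw≡cu →
    proper (colouring-of-half h) (K∩A⊆Half h w∈K∩A) (K∩B⊆Half h w′∈K∩B)
      (A-B-complete w w′ (K∩A-part w∈K∩A) (K∩B-part w′∈K∩B)) (trans cw≡cu (sym cw′≡cu))

  ω[T]≤∣K∩A∣ : ∀ {Q} → IsClique G Q → Q ⊆ T → ∣ Q ∣ ≤ ∣ K∩A ∣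
  ω[T]≤∣K∩A∣ {Q} Q-clique Q⊆T with clique-in-half Q-clique
  ... | h , Q⊆H = +-cancelʳ-≤ (∣ K∩B ∣) (∣ Q ∣) (∣ K∩A ∣) (begin
    ∣ Q ∣ + ∣ K∩B ∣               ≤⟨ cliques-with-disjoint-colours G (proper C) Q-clique Q⊆H
                                      K∩B-clique (K∩B⊆Half h)
                                      (λ u∈Q → T-avoids-K∩B h (Q⊆H u∈Q) (Q⊆T u∈Q)) ⟩
    colours C                     ≤⟨ colours≤∣K∣ C ⟩
    ∣ K ∣                         ≡⟨ sym K-split ⟩
    ∣ K∩A ∣ + ∣ K∩B ∣             ∎)
    where
    open ≤-Reasoning
    C = colouring-of-half h

  ω[∁T]≤∣K∩B∣ : ∀ {Q} → IsClique G Q → Q ⊆ ∁ T → ∣ Q ∣ ≤ ∣ K∩B ∣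
  ω[∁T]≤∣K∩B∣ {Q} Q-clique Q⊆∁T with clique-in-half Q-clique
  ... | h , Q⊆H = +-cancelˡ-≤ (∣ K∩A ∣) (∣ Q ∣) (∣ K∩B ∣) (begin
    ∣ K∩A ∣ + ∣ Q ∣               ≤⟨ cliques-with-disjoint-colours G (proper C) K∩A-clique (K∩A⊆Half h)
                                      Q-clique Q⊆H
                                      (λ w∈K∩A u∈Q → K∩A-avoids-∁T h w∈K∩A (Q⊆H u∈Q) (x∈∁p⇒x∉p (Q⊆∁T u∈Q))) ⟩
    colours C                     ≤⟨ colours≤∣K∣ C ⟩
    ∣ K ∣                         ≡⟨ sym K-split ⟩
    ∣ K∩A ∣ + ∣ K∩B ∣             ∎)
    where
    open ≤-Reasoning
    C = colouring-of-half h

  colouring : Σ (Fin n → Fin ∣ K ∣) (ProperOn G ⊤)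
  colouring = recolour ∘ glue G T (colour C₁) (colour C₂)
            , properOn-∘ G recolour-injective (properOn-glue G (proper C₁) (proper C₂))
    where
    C₁ : OptimalColouring G T
    C₁ = perfect⇒optimalColouring G
      (proper⇒perfect T (witness 1F , B∩T-empty (part-witness 1F)))
      (witness 0F , A⊆T (part-witness 0F))

    C₂ : OptimalColouring G (∁ T)
    C₂ = perfect⇒optimalColouring G
      (proper⇒perfect (∁ T) (witness 0F , x∈p⇒x∉∁p (A⊆T (part-witness 0F))))
      (witness 1F , x∉p⇒x∈∁p (B∩T-empty (part-witness 1F)))

    k₁+k₂≤∣K∣ : colours C₁ + colours C₂ ≤ ∣ K ∣
    k₁+k₂≤∣K∣ = subst (colours C₁ + colours C₂ ≤_) K-split
      (+-mono-≤ (optimalColouring-colours≤ G C₁ ω[T]≤∣K∩A∣) (optimalColouring-colours≤ G C₂ ω[∁T]≤∣K∩B∣))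

    recolour : Fin (colours C₁) ⊎ Fin (colours C₂) → Fin ∣ K ∣
    recolour x = inject≤ (join (colours C₁) (colours C₂) x) k₁+k₂≤∣K∣

    recolour-injective : Injective _≡_ _≡_ recolour
    recolour-injective = join-injective _ _ ∘ inject≤-injective k₁+k₂≤∣K∣ k₁+k₂≤∣K∣ _ _

lemma4p4 : (n : ℕ) (G : Graph n) → MinimallyImperfect G →
    (part : Fin n → Fin 4) →
    (∀ (i : Fin 4) → ∃ λ v → part v ≡ i) →
    (∀ u v → part u ≡ zero → part v ≡ suc zero → adj G u v ≡ true) →
    (∀ u v → part u ≡ suc (suc zero) → part v ≡ suc (suc (suc zero)) → adj G u v ≡ false) →
    (ω : ℕ) → IsCliqueNumber G ⊤ ω →
    (K : Subset n) → IsClique G K → ∣ K ∣ ≡ ω →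
    ¬ (∀ v → v ∈ K → part v ≡ zero ⊎ part v ≡ suc zero)
lemma4p4 n G (imperfect , proper⇒perfect) part part-nonempty A-B-complete C-D-anticomplete
         ω ω-clique-number K K-clique ∣K∣≡ω K⊆A∪B =
  imperfect (ω-colourable⇒perfect G proper⇒perfect K-clique K-maximum (proj₁ colouring) (proj₂ colouring))
  where
  K-maximum : ∀ Q → IsClique G Q → ∣ Q ∣ ≤ ∣ K ∣
  K-maximum Q Q-clique = subst (∣ Q ∣ ≤_) (sym ∣K∣≡ω) (proj₂ ω-clique-number Q ⊆⊤ Q-clique)

  open FourPartition G part part-nonempty A-B-complete C-D-anticomplete proper⇒perfect
                     K K-clique K-maximum K⊆A∪B
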